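{- Let $\mathcal{L}$ be an interval greedoid on a finite alphabet $E$. Then $\mathcal{L}$ with the composition $\circ$ is an LRB semigroup (with identity the empty word). Moreover its poset of flats $\Phi$ is its support lattice, with support map $\mathcal{L}\to\Phi$, $\alpha\mapsto[\alpha]$; that is, $\Phi$ is a lattice, $\alpha\mapsto[\alpha]$ is order-preserving and surjective, and for all $\alpha,\beta\in\mathcal{L}$: $[\alpha\circ\beta]=[\alpha]\vee[\beta]$, and $[\beta]\le[\alpha]$ if and only if $\alpha\circ\beta=\alpha$.
   Context: $E^*$ is the set of words $x_1x_2\cdots x_k$ with distinct letters from $E$. A greedoid is $\mathcal{L}\subseteq E^*$ such that (G1) $\alpha\beta\in\mathcal{L}\Rightarrow\alpha\in\mathcal{L}$, and (G2) if $\alpha,\beta\in\mathcal{L}$ with $|\alpha|>|\beta|$ then $\alpha$ contains a letter $x$ with $\beta x\in\mathcal{L}$. It is an interval greedoid if (G1) holds together with (G3): if $\alpha,\beta\in\mathcal{L}$ and $|\alpha|>|\beta|$ then $\alpha$ contains a subword $\gamma$ (obtained by deleting letters) of length $|\alpha|-|\beta|$ with $\beta\gamma\in\mathcal{L}$. Composition: for $\alpha\in\mathcal{L}$ and $y_1\cdots y_k\in\mathcal{L}$, $\alpha\circ y_1\cdots y_k$ is obtained starting from $\alpha$ by processing $y_1,\dots,y_k$ from left to right and appending $y_i$ to the current word exactly when the result stays in $\mathcal{L}$. Flats: $\alpha\sim\beta$ iff $\{\gamma:\alpha\gamma\in\mathcal{L}\}=\{\gamma:\beta\gamma\in\mathcal{L}\}$;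 $\Phi=\mathcal{L}/\sim$ ordered by $[\alpha]\le[\beta]$ iff $\alpha\gamma\sim\beta$ for some $\gamma\in E^*$. An LRB semigroup is a finite semigroup with identity satisfying $x^2=x$ and $xyx=xy$; it is ordered by $x\le y\iff xy=y$. -}

module Defs where

open import Data.Bool using (Bool; true; false; if_then_else_)
open import Data.Fin using (Fin)
open import Data.List using (List; []; _∷_; _++_; [_]; length)
open import Data.List.Relation.Unary.Unique.Propositional using (Unique)
open import Data.List.Relation.Binary.Sublist.Propositional using (_⊆_)
open import Data.Nat using (ℕ; _>_; _∸_)
open import Data.Product using (Σ; ∃; ∃₂; _×_; proj₁)
open import Function.Bundles using (_⇔_)
open import Relation.Binary.PropositionalEquality using (_≡_)
open import Relation.Binary.Structures using (IsPartialOrder)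
open import Relation.Binary.Lattice using (IsLattice)

Word : ℕ → Set
Word n = List (Fin n)

Language : ℕ → Set
Language n = Word n → Bool

module _ {n : ℕ} (L : Language n) where

  Feasible : Word n → Set
  Feasible α = L α ≡ true

  record IsIntervalGreedoid : Set where
    field
      distinct  : ∀ α → Feasible α → Unique α
      nonempty  : Feasible []
      G1        : ∀ α β → Feasible (α ++ β) → Feasible α
      G3        : ∀ α β → Feasible α → Feasible β → length α > length β →
                  ∃ λ γ → (γ ⊆ α) × (length γ ≡ length α ∸ length β) × Feasible (β ++ γ)

  compose : Word n → Word n → Word n
  compose α []       = α
  compose α (y ∷ ys) = if L (α ++ [ y ]) then compose (α ++ [ y ]) ys else compose α ys

  _∼_ : Word n → Word n → Set
  α ∼ β = ∀ γ → L (α ++ γ) ≡ L (β ++ γ)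

  _≤Φ_ : Word n → Word n → Set
  α ≤Φ β = ∃ λ γ → (α ++ γ) ∼ β

  -- Φ = 𝓛/∼, represented as the setoid of feasible words modulo ∼
  Flat : Set
  Flat = Σ (Word n) Feasible

  _≈ꜰ_ : Flat → Flat → Set
  a ≈ꜰ b = proj₁ a ∼ proj₁ b

  _≤ꜰ_ : Flat → Flat → Set
  a ≤ꜰ b = proj₁ a ≤Φ proj₁ b

  record IsLRB : Set where
    field
      closed   : ∀ α β → Feasible α → Feasible β → Feasible (compose α β)
      identityˡ : ∀ α → Feasible α → compose [] α ≡ α
      identityʳ : ∀ α → Feasible α → compose α [] ≡ α
      assoc    : ∀ α β γ → Feasible α → Feasible β → Feasible γ →
                 compose (compose α β) γ ≡ compose α (compose β γ)
      idem     : ∀ α → Feasible α → compose α α ≡ α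
      lrb      : ∀ α β → Feasible α → Feasible β →
                 compose (compose α β) α ≡ compose α β

  record IsSupportLattice : Set where
    field
      poset     : IsPartialOrder _≈ꜰ_ _≤ꜰ_
      lattice   : ∃₂ λ _∨_ _∧_ → IsLattice _≈ꜰ_ _≤ꜰ_ _∨_ _∧_
      -- order preserving: α ≤ β in the LRB (α ∘ β = β) ⇒ [α] ≤ [β]
      monotone  : ∀ α β → Feasible α → Feasible β → compose α β ≡ β → α ≤Φ β
      surjective : ∀ (x : Flat) → ∃ λ α → Feasible α × (α ∼ proj₁ x)
      -- [α ∘ β] = [α] ∨ [β]  (the least upper bound in Φ)
      join-ubˡ  : ∀ α β → Feasible α → Feasible β → α ≤Φ compose α β
      join-ubʳ  : ∀ α β → Feasible α → Feasible β → β ≤Φ compose α β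
      join-lub  : ∀ α β δ → Feasible α → Feasible β → Feasible δ →
                  α ≤Φ δ → β ≤Φ δ → compose α β ≤Φ δ
      le-iff    : ∀ α β → Feasible α → Feasible β → (β ≤Φ α) ⇔ (compose α β ≡ α)

module Submission where

-- Everything is organised around rejection: a word X rejects a letter y
-- when X y ∉ 𝓛.  The central fact is the characterisation
--
--     for feasible α, β :   [β] ≤ [α]  ⇔  α rejects every letter of β,
--
-- whose non-trivial direction (rejects⇒≼) uses (G3) twice: to fill β up
-- with letters of α until it is as long as α, and to show that two feasible
-- words rejecting each other's letters stay mutually rejecting when one
-- letter is appended to both, hence have the same continuations (α ∼ β).
-- With this in hand, composition is analysed by tracking an invariant along
-- the letters processed: this gives [β] ≤ [α ∘ β], associativity, and the
-- fact that [α ∘ β] is the join of [α] and [β].  Meets exist because a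
-- greedy saturation produces a feasible word, over the letters rejected by
-- both a and b, that rejects all of them.

open import Defs
open import Data.Bool using (Bool; true; false)
open import Data.Bool.Properties using (¬-not) renaming (_≟_ to _≟ᵇ_)
open import Data.Empty using (⊥; ⊥-elim)
open import Data.Fin using (Fin)
open import Data.Fin.Properties using (injective⇒≤)
open import Data.List using (List; []; _∷_; _++_; [_]; length; filter; allFin; lookup)
open import Data.List.Properties using (++-assoc; ++-identityʳ; length-++; length-++-sucʳ)
open import Data.List.Membership.Propositional using (_∈_)
open import Data.List.Membership.Propositional.Properties
  using (∈-++⁺ˡ; ∈-++⁺ʳ; ∈-++⁻; ∈-lookup; ∈-allFin; ∈-filter⁺; ∈-filter⁻)
open import Data.List.Relation.Unary.All as All using (All; []; _∷_)
open import Data.List.Relation.Unary.All.Properties using (++⁺)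
open import Data.List.Relation.Unary.Any using (here; there)
open import Data.List.Relation.Unary.AllPairs using (_∷_)
open import Data.List.Relation.Unary.Unique.Propositional using (Unique)
open import Data.List.Relation.Binary.Sublist.Propositional using (_⊆_; _∷_; _∷ʳ_)
open import Data.List.Relation.Binary.Sublist.Propositional.Properties using (Any-resp-⊆)
open import Data.Nat using (ℕ; zero; suc; _+_; _∸_; _≤_; _>_; z≤n; s≤s)
open import Data.Nat.Properties
  using (≤-reflexive; ≤-trans; ≤-antisym; n≤1+n; <⇒≤; ≮⇒≥; 1+n≰n; m≤m+n; m≤n⇒m<n∨m≡n;
         m>n⇒m∸n≢0; m+[n∸m]≡n; m+n∸n≡m; m+1+n≢m; +-comm; module ≤-Reasoning)
open import Data.Product using (_×_; _,_; proj₁; proj₂; ∃; ∃₂)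
open import Data.Sum using (_⊎_; inj₁; inj₂)
open import Function using (id; _∘_)
open import Function.Bundles using (mk⇔)
open import Relation.Binary.PropositionalEquality
  using (_≡_; refl; sym; trans; cong; subst; subst₂; module ≡-Reasoning)
open import Relation.Binary.Structures using (IsPartialOrder)
open import Relation.Binary.Lattice using (IsLattice)
open import Relation.Nullary.Decidable using (Dec; _×-dec_)

-- Lists with distinct entries: lookup is injective, so such a list of
-- letters from Fin n has at most n entries.  This bounds the saturation
-- used to construct meets.
lookup-injective : ∀ {A : Set} (xs : List A) → Unique xs →
                   ∀ {i j} → lookup xs i ≡ lookup xs j → i ≡ j
lookup-injective (x ∷ xs) u         {Fin.zero}  {Fin.zero}  e = refl
lookup-injective (x ∷ xs) (x∉ ∷ u) {Fin.zero}  {Fin.suc j} e = ⊥-elim (All.lookup x∉ (∈-lookup j) e)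
lookup-injective (x ∷ xs) (x∉ ∷ u) {Fin.suc i} {Fin.zero}  e = ⊥-elim (All.lookup x∉ (∈-lookup i) (sym e))
lookup-injective (x ∷ xs) (x∉ ∷ u) {Fin.suc i} {Fin.suc j} e = cong Fin.suc (lookup-injective xs u e)

unique-length≤ : ∀ {n} (xs : List (Fin n)) → Unique xs → length xs ≤ n
unique-length≤ xs u = injective⇒≤ (lookup-injective xs u)

length-snoc : ∀ {A : Set} (xs : List A) x → length (xs ++ [ x ]) ≡ suc (length xs)
length-snoc xs x = trans (length-++-sucʳ xs x []) (cong (suc ∘ length) (++-identityʳ xs))

sublist-of-snoc₂ : ∀ {A : Set} (α : List A) {u v x y : A} →
                   (u ∷ v ∷ []) ⊆ α ++ (x ∷ y ∷ []) → u ∈ α ⊎ (u ≡ x × v ≡ y)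
sublist-of-snoc₂ []      (refl ∷ (refl ∷ _)) = inj₂ (refl , refl)
sublist-of-snoc₂ []      (refl ∷ (_ ∷ʳ ()))
sublist-of-snoc₂ []      (_ ∷ʳ (refl ∷ ()))
sublist-of-snoc₂ []      (_ ∷ʳ (_ ∷ʳ ()))
sublist-of-snoc₂ (a ∷ α) (refl ∷ _) = inj₁ (here refl)
sublist-of-snoc₂ (a ∷ α) (_ ∷ʳ s) with sublist-of-snoc₂ α s
... | inj₁ u∈α = inj₁ (there u∈α)
... | inj₂ uv≡xy = inj₂ uv≡xy

module LanguageFacts {n : ℕ} (L : Language n) where

  infix 4 _≈_ _≼_
  _≈_ : Word n → Word n → Set
  _≈_ = _∼_ L

  _≼_ : Word n → Word n → Set
  _≼_ = _≤Φ_ L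

  Rejects : Word n → Word n → Set
  Rejects X ys = All (λ y → L (X ++ [ y ]) ≡ false) ys

  compose-extends : ∀ X ys → ∃ λ δ → compose L X ys ≡ X ++ δ
  compose-extends X [] = [] , sym (++-identityʳ X)
  compose-extends X (y ∷ ys) with L (X ++ [ y ])
  ... | true  = let δ , e = compose-extends (X ++ [ y ]) ys in y ∷ δ , trans e (++-assoc X [ y ] δ)
  ... | false = compose-extends X ys

  compose-feasible : ∀ X ys → Feasible L X → Feasible L (compose L X ys)
  compose-feasible X [] fX = fX
  compose-feasible X (y ∷ ys) fX with L (X ++ [ y ]) in e
  ... | true  = compose-feasible (X ++ [ y ]) ys e
  ... | false = compose-feasible X ys fX

  compose-++ : ∀ X u v → compose L X (u ++ v) ≡ compose L (compose L X u) v
  compose-++ X [] v = refl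
  compose-++ X (y ∷ u) v with L (X ++ [ y ])
  ... | true  = compose-++ (X ++ [ y ]) u v
  ... | false = compose-++ X u v

  compose-rejected : ∀ X ys → Rejects X ys → compose L X ys ≡ X
  compose-rejected X [] [] = refl
  compose-rejected X (y ∷ ys) (r ∷ rs) rewrite r = compose-rejected X ys rs

  compose-fixed⇒rejects : ∀ X ys → compose L X ys ≡ X → Rejects X ys
  compose-fixed⇒rejects X [] _ = []
  compose-fixed⇒rejects X (y ∷ ys) fixed with L (X ++ [ y ]) in e
  ... | true  = ⊥-elim (m+1+n≢m (length X) (trans (sym (length-++ X)) (cong length grown)))
    where
    δ = proj₁ (compose-extends (X ++ [ y ]) ys)
    grown : X ++ y ∷ δ ≡ X
    grown = trans (sym (++-assoc X [ y ] δ)) (trans (sym (proj₂ (compose-extends (X ++ [ y ]) ys))) fixed)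
  ... | false = e ∷ compose-fixed⇒rejects X ys fixed

  compose-letters : ∀ {Q : Fin n → Set} X ys → All Q X → All Q ys → All Q (compose L X ys)
  compose-letters X [] qX _ = qX
  compose-letters X (y ∷ ys) qX (qy ∷ qys) with L (X ++ [ y ])
  ... | true  = compose-letters (X ++ [ y ]) ys (++⁺ qX (qy ∷ [])) qys
  ... | false = compose-letters X ys qX qys

  ≈-refl : ∀ α → α ≈ α
  ≈-refl α γ = refl

  ≈-sym : ∀ {α β} → α ≈ β → β ≈ α
  ≈-sym α≈β γ = sym (α≈β γ)

  ≈-trans : ∀ {α β γ} → α ≈ β → β ≈ γ → α ≈ γ
  ≈-trans α≈β β≈γ δ = trans (α≈β δ) (β≈γ δ)

  ≈-++ʳ : ∀ {α β} δ → α ≈ β → (α ++ δ) ≈ (β ++ δ)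
  ≈-++ʳ {α} {β} δ α≈β γ = begin
    L ((α ++ δ) ++ γ) ≡⟨ cong L (++-assoc α δ γ) ⟩
    L (α ++ δ ++ γ)   ≡⟨ α≈β (δ ++ γ) ⟩
    L (β ++ δ ++ γ)   ≡⟨ cong L (++-assoc β δ γ) ⟨
    L ((β ++ δ) ++ γ) ∎
    where open ≡-Reasoning

  ≈-feasible : ∀ {α β} → α ≈ β → Feasible L β → Feasible L α
  ≈-feasible {α} {β} α≈β fβ = begin
    L α        ≡⟨ cong L (++-identityʳ α) ⟨
    L (α ++ []) ≡⟨ α≈β [] ⟩
    L (β ++ []) ≡⟨ cong L (++-identityʳ β) ⟩
    L β        ≡⟨ fβ ⟩
    true       ∎
    where open ≡-Reasoning

  ≈⇒≼ : ∀ {α β} → α ≈ β → α ≼ β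
  ≈⇒≼ {α} α≈β = [] , λ γ → trans (cong (λ w → L (w ++ γ)) (++-identityʳ α)) (α≈β γ)

  ≼-trans : ∀ {α β γ} → α ≼ β → β ≼ γ → α ≼ γ
  ≼-trans {α} {β} (δ , αδ≈β) (ε , βε≈γ) =
    δ ++ ε , ≈-trans (λ ζ → cong (λ w → L (w ++ ζ)) (sym (++-assoc α δ ε)))
                     (≈-trans (≈-++ʳ ε αδ≈β) βε≈γ)

  []≼ : ∀ α → [] ≼ α
  []≼ α = α , ≈-refl α

  ≼-compose : ∀ α β → α ≼ compose L α β
  ≼-compose α β = let δ , e = compose-extends α β in δ , λ γ → cong (λ w → L (w ++ γ)) (sym e)

module Greedoid {n : ℕ} {L : Language n} (G : IsIntervalGreedoid L) where
  open IsIntervalGreedoid G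
  open LanguageFacts L

  false-unless-true : ∀ {b : Bool} → (b ≡ true → ⊥) → b ≡ false
  false-unless-true {b} = ¬-not {b} {true}

  not-both : ∀ {b : Bool} → b ≡ true → b ≡ false → ⊥
  not-both refl ()

  feasible-reassoc : ∀ p y ys → Feasible L (p ++ y ∷ ys) → Feasible L ((p ++ [ y ]) ++ ys)
  feasible-reassoc p y ys = subst (Feasible L) (sym (++-assoc p [ y ] ys))

  feasible-snoc : ∀ p y ys → Feasible L (p ++ y ∷ ys) → Feasible L (p ++ [ y ])
  feasible-snoc p y ys f = G1 (p ++ [ y ]) ys (feasible-reassoc p y ys f)

  infeasible-++ : ∀ α β → L α ≡ false → L (α ++ β) ≡ false
  infeasible-++ α β e = false-unless-true λ f → not-both (G1 α β f) e

  repeated-letter : ∀ {y : Fin n} xs ys → y ∈ xs → y ∈ ys → Unique (xs ++ ys) → ⊥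
  repeated-letter (x ∷ xs) ys (here refl) y∈ys (x∉ ∷ _) = All.lookup x∉ (∈-++⁺ʳ xs y∈ys) refl
  repeated-letter (x ∷ xs) ys (there y∈xs) y∈ys (_ ∷ u) = repeated-letter xs ys y∈xs y∈ys u

  rejects-own-letters : ∀ X ys → All (_∈ X) ys → Rejects X ys
  rejects-own-letters X ys = All.map λ y∈X →
    false-unless-true λ f → repeated-letter X _ y∈X (here refl) (distinct _ f)

  exchange : ∀ α β → Feasible L α → Feasible L β → length α > length β →
             ∃ λ w → w ∈ α × Feasible L (β ++ [ w ])
  exchange α β fα fβ lt with G3 α β fα fβ lt
  ... | []    , _   , len , _   = ⊥-elim (m>n⇒m∸n≢0 lt (sym len))
  ... | w ∷ γ , sub , _   , fβγ = w , Any-resp-⊆ sub (here refl) , feasible-snoc β w γ fβγ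

  rejecting⇒longer : ∀ α δ → Feasible L α → Feasible L δ → Rejects α δ → length δ ≤ length α
  rejecting⇒longer α δ fα fδ r = ≮⇒≥ λ lt →
    let w , w∈δ , fαw = exchange δ α fδ fα lt in not-both fαw (All.lookup r w∈δ)

  augment : ∀ α β → Feasible L α → Feasible L β → length β ≤ length α →
            ∃ λ γ → All (_∈ α) γ × length (β ++ γ) ≡ length α × Feasible L (β ++ γ)
  augment α β fα fβ β≤α with m≤n⇒m<n∨m≡n β≤α
  ... | inj₂ eq = [] , [] , trans (cong length (++-identityʳ β)) eq
                          , subst (Feasible L) (sym (++-identityʳ β)) fβ
  ... | inj₁ lt with G3 α β fα fβ lt
  ...   | γ , sub , len , fβγ = γ , All.tabulate (Any-resp-⊆ sub) , filled , fβγ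
    where
    open ≡-Reasoning
    filled : length (β ++ γ) ≡ length α
    filled = begin
      length (β ++ γ)                ≡⟨ length-++ β ⟩
      length β + length γ            ≡⟨ cong (length β +_) len ⟩
      length β + (length α ∸ length β) ≡⟨ m+[n∸m]≡n (<⇒≤ lt) ⟩
      length α                       ∎

  rejects-flip : ∀ α δ → Feasible L α → Rejects α δ → length α ≤ length δ → Rejects δ α
  rejects-flip α δ fα r α≤δ = All.tabulate λ {z} z∈α → false-unless-true λ fδz →
    1+n≰n (begin
      suc (length δ)      ≡⟨ length-snoc δ z ⟨
      length (δ ++ [ z ]) ≤⟨ rejecting⇒longer α (δ ++ [ z ]) fα fδz
                               (++⁺ r (rejects-own-letters α [ z ] (z∈α ∷ []))) ⟩
      length α            ≤⟨ α≤δ ⟩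
      length δ            ∎)
    where open ≤-Reasoning

  record MutuallyRejecting (α β : Word n) : Set where
    field
      feasibleˡ : Feasible L α
      feasibleʳ : Feasible L β
      rejectsˡ  : Rejects α β
      rejectsʳ  : Rejects β α

  mutual-sym : ∀ {α β} → MutuallyRejecting α β → MutuallyRejecting β α
  mutual-sym m = record { feasibleˡ = feasibleʳ ; feasibleʳ = feasibleˡ ; rejectsˡ = rejectsʳ ; rejectsʳ = rejectsˡ }
    where open MutuallyRejecting m

  mutual-length : ∀ {α β} → MutuallyRejecting α β → length α ≡ length β
  mutual-length {α} {β} m = ≤-antisym
    (rejecting⇒longer β α feasibleʳ feasibleˡ rejectsʳ) (rejecting⇒longer α β feasibleˡ feasibleʳ rejectsˡ)
    where open MutuallyRejecting m

  mutual-snoc-feasible : ∀ {α β} x → MutuallyRejecting α β → Feasible L (α ++ [ x ]) → Feasible L (β ++ [ x ])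
  mutual-snoc-feasible {α} {β} x m fαx with L (β ++ [ x ]) in e
  ... | true  = refl
  ... | false = ⊥-elim (1+n≰n (begin
      suc (length α)      ≡⟨ length-snoc α x ⟨
      length (α ++ [ x ]) ≤⟨ rejecting⇒longer β (α ++ [ x ]) feasibleʳ fαx (++⁺ rejectsʳ (e ∷ [])) ⟩
      length β            ≡⟨ mutual-length m ⟨
      length α            ∎))
    where
    open MutuallyRejecting m
    open ≤-Reasoning

  -- The interval property at work: appending x to α keeps rejecting the letters of β x.
  snoc-rejects : ∀ {α β} x → MutuallyRejecting α β → Rejects (α ++ [ x ]) (β ++ [ x ])
  snoc-rejects {α} {β} x m =
    ++⁺ (All.tabulate λ y∈β → false-unless-true (no-extension y∈β))
        (rejects-own-letters (α ++ [ x ]) [ x ] (∈-++⁺ʳ α (here refl) ∷ []))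
    where
    open MutuallyRejecting m
    two-longer : ∀ y → length ((α ++ [ x ]) ++ [ y ]) ≡ 2 + length β
    two-longer y = begin
      length ((α ++ [ x ]) ++ [ y ]) ≡⟨ cong length (++-assoc α [ x ] [ y ]) ⟩
      length (α ++ x ∷ y ∷ [])       ≡⟨ length-++ α ⟩
      length α + 2                   ≡⟨ +-comm (length α) 2 ⟩
      2 + length α                   ≡⟨ cong (2 +_) (mutual-length m) ⟩
      2 + length β                   ∎
      where open ≡-Reasoning
    two-letters : (γ : Word n) → length γ ≡ 2 → ∃₂ λ u v → γ ≡ u ∷ v ∷ []
    two-letters (u ∷ v ∷ []) _ = u , v , refl
    -- By (G3), β extends by two letters u v of α x y; u ∉ α since β rejects α,
    -- so u v = x y, and β x y repeats y.
    no-extension : ∀ {y} → y ∈ β → Feasible L ((α ++ [ x ]) ++ [ y ]) → ⊥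
    no-extension {y} y∈β fαxy
      with G3 _ β fαxy feasibleʳ (≤-trans (n≤1+n _) (≤-reflexive (sym (two-longer y))))
    ... | γ , sub , len , fβγ
      with two-letters γ (trans len (trans (cong (_∸ length β) (two-longer y)) (m+n∸n≡m 2 (length β))))
    ... | u , v , refl with sublist-of-snoc₂ α (subst ((u ∷ v ∷ []) ⊆_) (++-assoc α [ x ] [ y ]) sub)
    ... | inj₁ u∈α = not-both (feasible-snoc β u (v ∷ []) fβγ) (All.lookup rejectsʳ u∈α)
    ... | inj₂ (refl , refl) = repeated-letter β (x ∷ y ∷ []) y∈β (there (here refl)) (distinct _ fβγ)

  mutual-snoc : ∀ {α β} x → MutuallyRejecting α β → Feasible L (α ++ [ x ]) →
                MutuallyRejecting (α ++ [ x ]) (β ++ [ x ])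
  mutual-snoc x m fαx = record
    { feasibleˡ = fαx
    ; feasibleʳ = mutual-snoc-feasible x m fαx
    ; rejectsˡ  = snoc-rejects x m
    ; rejectsʳ  = snoc-rejects x (mutual-sym m)
    }

  mutual⇒≈ : ∀ {α β} → MutuallyRejecting α β → α ≈ β
  mutual⇒≈ {α} {β} m [] = begin
    L (α ++ []) ≡⟨ cong L (++-identityʳ α) ⟩
    L α         ≡⟨ trans feasibleˡ (sym feasibleʳ) ⟩
    L β         ≡⟨ cong L (++-identityʳ β) ⟨
    L (β ++ []) ∎
    where
    open MutuallyRejecting m
    open ≡-Reasoning
  mutual⇒≈ {α} {β} m (x ∷ γ) with L (α ++ [ x ]) in e
  ... | true = begin
    L (α ++ x ∷ γ)       ≡⟨ cong L (++-assoc α [ x ] γ) ⟨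
    L ((α ++ [ x ]) ++ γ) ≡⟨ mutual⇒≈ (mutual-snoc x m e) γ ⟩
    L ((β ++ [ x ]) ++ γ) ≡⟨ cong L (++-assoc β [ x ] γ) ⟩
    L (β ++ x ∷ γ)       ∎
    where open ≡-Reasoning
  ... | false = begin
    L (α ++ x ∷ γ)       ≡⟨ cong L (++-assoc α [ x ] γ) ⟨
    L ((α ++ [ x ]) ++ γ) ≡⟨ infeasible-++ (α ++ [ x ]) γ e ⟩
    false                ≡⟨ infeasible-++ (β ++ [ x ]) γ βx-infeasible ⟨
    L ((β ++ [ x ]) ++ γ) ≡⟨ cong L (++-assoc β [ x ] γ) ⟩
    L (β ++ x ∷ γ)       ∎
    where
    open ≡-Reasoning
    βx-infeasible : L (β ++ [ x ]) ≡ false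
    βx-infeasible = false-unless-true λ fβx → not-both (mutual-snoc-feasible x (mutual-sym m) fβx) e

  ≼⇒rejects : ∀ α β → β ≼ α → Rejects α β
  ≼⇒rejects α β (γ , βγ≈α) = All.tabulate λ {y} y∈β →
    trans (sym (βγ≈α [ y ])) (false-unless-true λ f →
      repeated-letter β (γ ++ [ y ]) y∈β (∈-++⁺ʳ γ (here refl))
        (subst Unique (++-assoc β γ [ y ]) (distinct _ f)))

  rejects⇒≼ : ∀ α β → Feasible L α → Feasible L β → Rejects α β → β ≼ α
  rejects⇒≼ α β fα fβ r with augment α β fα fβ (rejecting⇒longer α β fα fβ r)
  ... | γ , γ⊆α , len , fβγ = γ , mutual⇒≈ (record
      { feasibleˡ = fβγ
      ; feasibleʳ = fα
      ; rejectsˡ  = rejects-flip α (β ++ γ) fα α-rejects (≤-reflexive (sym len))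
      ; rejectsʳ  = α-rejects
      })
    where
    α-rejects : Rejects α (β ++ γ)
    α-rejects = ++⁺ r (rejects-own-letters α γ γ⊆α)

  ≼-antisym : ∀ α β → Feasible L α → Feasible L β → α ≼ β → β ≼ α → α ≈ β
  ≼-antisym α β fα fβ α≼β β≼α = mutual⇒≈ (record
    { feasibleˡ = fα
    ; feasibleʳ = fβ
    ; rejectsˡ  = ≼⇒rejects α β β≼α
    ; rejectsʳ  = ≼⇒rejects β α α≼β
    })

  compose-feasible-word : ∀ p ys → Feasible L (p ++ ys) → compose L p ys ≡ p ++ ys
  compose-feasible-word p [] _ = sym (++-identityʳ p)
  compose-feasible-word p (y ∷ ys) f with L (p ++ [ y ]) in e
  ... | true  = trans (compose-feasible-word (p ++ [ y ]) ys (feasible-reassoc p y ys f)) (++-assoc p [ y ] ys)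
  ... | false = ⊥-elim (not-both (feasible-snoc p y ys f) e)

  ≼-snoc-rejected : ∀ p V y → Feasible L V → Feasible L (p ++ [ y ]) → L (V ++ [ y ]) ≡ false →
                    p ≼ V → (p ++ [ y ]) ≼ V
  ≼-snoc-rejected p V y fV fpy r p≼V = rejects⇒≼ V (p ++ [ y ]) fV fpy (++⁺ (≼⇒rejects V p p≼V) (r ∷ []))

  ≼-step : ∀ p V y → Feasible L V → Feasible L (p ++ [ y ]) → p ≼ V → (p ++ [ y ]) ≼ compose L V [ y ]
  ≼-step p V y fV fpy p≼V with L (V ++ [ y ]) in e
  ... | false = ≼-snoc-rejected p V y fV fpy e p≼V
  ... | true  = ≼-trans py≼pδy (≈⇒≼ pδy≈Vy)
    where
    δ = proj₁ p≼V
    pδy≈Vy : ((p ++ δ) ++ [ y ]) ≈ (V ++ [ y ])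
    pδy≈Vy = ≈-++ʳ [ y ] (proj₂ p≼V)
    letters : ∀ {z} → z ∈ p ++ [ y ] → z ∈ (p ++ δ) ++ [ y ]
    letters z∈ with ∈-++⁻ p z∈
    ... | inj₁ z∈p = ∈-++⁺ˡ (∈-++⁺ˡ z∈p)
    ... | inj₂ z∈y = ∈-++⁺ʳ (p ++ δ) z∈y
    py≼pδy : (p ++ [ y ]) ≼ ((p ++ δ) ++ [ y ])
    py≼pδy = rejects⇒≼ _ _ (≈-feasible pδy≈Vy e) fpy (rejects-own-letters _ _ (All.tabulate letters))

  ≼-compose-tracking : ∀ p V ys → Feasible L V → Feasible L (p ++ ys) → p ≼ V → (p ++ ys) ≼ compose L V ys
  ≼-compose-tracking p V [] _ _ p≼V = subst (_≼ V) (sym (++-identityʳ p)) p≼V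
  ≼-compose-tracking p V (y ∷ ys) fV fpys p≼V =
    subst₂ _≼_ (++-assoc p [ y ] ys) (sym (compose-++ V [ y ] ys))
      (≼-compose-tracking (p ++ [ y ]) (compose L V [ y ]) ys (compose-feasible V [ y ] fV)
        (feasible-reassoc p y ys fpys) (≼-step p V y fV (feasible-snoc p y ys fpys) p≼V))

  ≼-composeʳ : ∀ α β → Feasible L α → Feasible L β → β ≼ compose L α β
  ≼-composeʳ α β fα fβ = ≼-compose-tracking [] α β fα fβ ([]≼ α)

  compose-least : ∀ α β δ → Feasible L α → Feasible L δ → α ≼ δ → β ≼ δ → compose L α β ≼ δ
  compose-least α β δ fα fδ α≼δ β≼δ = rejects⇒≼ δ (compose L α β) fδ (compose-feasible α β fα)
    (compose-letters α β (≼⇒rejects δ α α≼δ) (≼⇒rejects δ β β≼δ))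

  compose-assoc-step : ∀ α Z p y → Feasible L α → Feasible L Z → Feasible L (p ++ [ y ]) → p ≼ Z →
                       compose L (compose L α Z) [ y ] ≡ compose L α (compose L Z [ y ])
  compose-assoc-step α Z p y fα fZ fpy p≼Z with L (Z ++ [ y ]) in e
  ... | true  = sym (compose-++ α Z [ y ])
  ... | false = compose-rejected (compose L α Z) [ y ] (All.lookup αZ-rejects (∈-++⁺ʳ p (here refl)) ∷ [])
    where
    -- [p y] ≤ [Z] ≤ [α ∘ Z], so α ∘ Z rejects y too.
    αZ-rejects : Rejects (compose L α Z) (p ++ [ y ])
    αZ-rejects = ≼⇒rejects (compose L α Z) (p ++ [ y ])
      (≼-trans (≼-snoc-rejected p Z y fZ fpy e p≼Z) (≼-composeʳ α Z fα fZ))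

  compose-assoc-tracking : ∀ α Z p ys → Feasible L α → Feasible L Z → Feasible L (p ++ ys) → p ≼ Z →
                           compose L (compose L α Z) ys ≡ compose L α (compose L Z ys)
  compose-assoc-tracking α Z p [] _ _ _ _ = refl
  compose-assoc-tracking α Z p (y ∷ ys) fα fZ fpys p≼Z = begin
    compose L (compose L α Z) (y ∷ ys)             ≡⟨ compose-++ (compose L α Z) [ y ] ys ⟩
    compose L (compose L (compose L α Z) [ y ]) ys ≡⟨ cong (λ W → compose L W ys) first-letter ⟩
    compose L (compose L α (compose L Z [ y ])) ys ≡⟨ remaining-letters ⟩
    compose L α (compose L (compose L Z [ y ]) ys) ≡⟨ cong (compose L α) (compose-++ Z [ y ] ys) ⟨
    compose L α (compose L Z (y ∷ ys))             ∎
    where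
    open ≡-Reasoning
    fpy : Feasible L (p ++ [ y ])
    fpy = feasible-snoc p y ys fpys
    first-letter : compose L (compose L α Z) [ y ] ≡ compose L α (compose L Z [ y ])
    first-letter = compose-assoc-step α Z p y fα fZ fpy p≼Z
    remaining-letters : compose L (compose L α (compose L Z [ y ])) ys
                      ≡ compose L α (compose L (compose L Z [ y ]) ys)
    remaining-letters = compose-assoc-tracking α (compose L Z [ y ]) (p ++ [ y ]) ys fα
      (compose-feasible Z [ y ] fZ) (feasible-reassoc p y ys fpys) (≼-step p Z y fZ fpy p≼Z)

  compose-assoc : ∀ α β γ → Feasible L α → Feasible L β → Feasible L γ →
                  compose L (compose L α β) γ ≡ compose L α (compose L β γ)
  compose-assoc α β γ fα fβ fγ = compose-assoc-tracking α β [] γ fα fβ fγ ([]≼ β)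

  compose-idempotent : ∀ α → compose L α α ≡ α
  compose-idempotent α = compose-rejected α α (rejects-own-letters α α (All.tabulate id))

  compose-left-regular : ∀ α β → compose L (compose L α β) α ≡ compose L α β
  compose-left-regular α β =
    compose-rejected (compose L α β) α (≼⇒rejects (compose L α β) α (≼-compose α β))

  -- Greedy saturation: composing [] with S over and over yields a feasible
  -- word with letters from S; each round either rejects all of S or grows
  -- the word, and growth stops by distinctness after n rounds.
  module Saturation (S : Word n) where
    saturate : ℕ → Word n
    saturate zero    = []
    saturate (suc k) = compose L (saturate k) S

    saturate-feasible : ∀ k → Feasible L (saturate k)
    saturate-feasible zero    = nonempty
    saturate-feasible (suc k) = compose-feasible (saturate k) S (saturate-feasible k)

    saturate-letters : ∀ k → All (_∈ S) (saturate k)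
    saturate-letters zero    = []
    saturate-letters (suc k) = compose-letters (saturate k) S (saturate-letters k) (All.tabulate id)

    rejects-stable : ∀ Y → Rejects Y S → Rejects (compose L Y S) S
    rejects-stable Y r = subst (λ W → Rejects W S) (sym (compose-rejected Y S r)) r

    saturate-progress : ∀ k → Rejects (saturate k) S ⊎ k ≤ length (saturate k)
    saturate-progress zero = inj₂ z≤n
    saturate-progress (suc k) with saturate-progress k | compose-extends (saturate k) S
    ... | inj₁ r  | _ = inj₁ (rejects-stable (saturate k) r)
    ... | inj₂ _  | [] , e = inj₁ (rejects-stable (saturate k) (compose-fixed⇒rejects (saturate k) S fixed))
      where
      fixed : compose L (saturate k) S ≡ saturate k
      fixed = trans e (++-identityʳ (saturate k))
    ... | inj₂ k≤ | d ∷ δ , e = inj₂ (subst (λ W → suc k ≤ length W) (sym e) (begin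
      suc k                              ≤⟨ s≤s k≤ ⟩
      suc (length (saturate k))          ≤⟨ s≤s (m≤m+n _ (length δ)) ⟩
      suc (length (saturate k) + length δ) ≡⟨ cong suc (length-++ (saturate k)) ⟨
      suc (length (saturate k ++ δ))     ≡⟨ length-++-sucʳ (saturate k) d δ ⟨
      length (saturate k ++ d ∷ δ)       ∎))
      where open ≤-Reasoning

    saturated : Word n
    saturated = saturate (suc n)

    saturated-rejects : Rejects saturated S
    saturated-rejects with saturate-progress (suc n)
    ... | inj₁ r = r
    ... | inj₂ long = ⊥-elim (1+n≰n (≤-trans long
                        (unique-length≤ saturated (distinct _ (saturate-feasible (suc n))))))

  BothReject : Word n → Word n → Fin n → Set
  BothReject a b s = L (a ++ [ s ]) ≡ false × L (b ++ [ s ]) ≡ false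

  bothReject? : ∀ a b s → Dec (BothReject a b s)
  bothReject? a b s = (L (a ++ [ s ]) ≟ᵇ false) ×-dec (L (b ++ [ s ]) ≟ᵇ false)

  commonRejects : Word n → Word n → Word n
  commonRejects a b = filter (bothReject? a b) (allFin n)

  commonRejects-sound : ∀ a b {s} → s ∈ commonRejects a b → BothReject a b s
  commonRejects-sound a b s∈ = proj₂ (∈-filter⁻ (bothReject? a b) {xs = allFin n} s∈)

  commonRejects-complete : ∀ a b {s} → BothReject a b s → s ∈ commonRejects a b
  commonRejects-complete a b {s} both = ∈-filter⁺ (bothReject? a b) (∈-allFin s) both

  meet : Word n → Word n → Word n
  meet a b = Saturation.saturated (commonRejects a b)

  meet-feasible : ∀ a b → Feasible L (meet a b)
  meet-feasible a b = Saturation.saturate-feasible (commonRejects a b) (suc n)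

  meet-letters : ∀ a b → All (BothReject a b) (meet a b)
  meet-letters a b = All.map (commonRejects-sound a b) (Saturation.saturate-letters (commonRejects a b) (suc n))

  meet-≼ˡ : ∀ a b → Feasible L a → meet a b ≼ a
  meet-≼ˡ a b fa = rejects⇒≼ a (meet a b) fa (meet-feasible a b) (All.map proj₁ (meet-letters a b))

  meet-≼ʳ : ∀ a b → Feasible L b → meet a b ≼ b
  meet-≼ʳ a b fb = rejects⇒≼ b (meet a b) fb (meet-feasible a b) (All.map proj₂ (meet-letters a b))

  meet-greatest : ∀ a b z → Feasible L z → z ≼ a → z ≼ b → z ≼ meet a b
  meet-greatest a b z fz z≼a z≼b = rejects⇒≼ (meet a b) z (meet-feasible a b) fz (All.tabulate λ y∈z →
    All.lookup (Saturation.saturated-rejects (commonRejects a b))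
      (commonRejects-complete a b (All.lookup (≼⇒rejects a z z≼a) y∈z , All.lookup (≼⇒rejects b z z≼b) y∈z)))

  joinꜰ : Flat L → Flat L → Flat L
  joinꜰ (α , fα) (β , _) = compose L α β , compose-feasible α β fα

  meetꜰ : Flat L → Flat L → Flat L
  meetꜰ (α , _) (β , _) = meet α β , meet-feasible α β

  flats-partialOrder : IsPartialOrder (_≈ꜰ_ L) (_≤ꜰ_ L)
  flats-partialOrder = record
    { isPreorder = record
      { isEquivalence = record { refl = λ {x} → ≈-refl (proj₁ x) ; sym = ≈-sym ; trans = ≈-trans }
      ; reflexive     = ≈⇒≼
      ; trans         = ≼-trans
      }
    ; antisym = λ { {α , fα} {β , fβ} → ≼-antisym α β fα fβ }
    }

  flats-lattice : IsLattice (_≈ꜰ_ L) (_≤ꜰ_ L) joinꜰ meetꜰ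
  flats-lattice = record
    { isPartialOrder = flats-partialOrder
    ; supremum = λ { (α , fα) (β , fβ) → ≼-compose α β , ≼-composeʳ α β fα fβ ,
                     λ { (δ , fδ) → compose-least α β δ fα fδ } }
    ; infimum  = λ { (α , fα) (β , fβ) → meet-≼ˡ α β fα , meet-≼ʳ α β fβ ,
                     λ { (z , fz) → meet-greatest α β z fz } }
    }

theorem4p15 : (n : ℕ) (L : Language n) → IsIntervalGreedoid L →
    IsLRB L × IsSupportLattice L
theorem4p15 n L G = isLRB , isSupportLattice
  where
  open LanguageFacts L
  open Greedoid G

  isLRB : IsLRB L
  isLRB = record
    { closed    = λ α β fα _ → compose-feasible α β fα
    ; identityˡ = λ α fα → compose-feasible-word [] α fα
    ; identityʳ = λ _ _ → refl
    ; assoc     = compose-assoc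
    ; idem      = λ α _ → compose-idempotent α
    ; lrb       = λ α β _ _ → compose-left-regular α β
    }

  isSupportLattice : IsSupportLattice L
  isSupportLattice = record
    { poset      = flats-partialOrder
    ; lattice    = joinꜰ , meetꜰ , flats-lattice
    ; monotone   = λ α β _ _ α∘β≡β → subst (α ≼_) α∘β≡β (≼-compose α β)
    ; surjective = λ (α , fα) → α , fα , ≈-refl α
    ; join-ubˡ   = λ α β _ _ → ≼-compose α β
    ; join-ubʳ   = ≼-composeʳ
    ; join-lub   = λ α β δ fα _ fδ → compose-least α β δ fα fδ
    ; le-iff     = λ α β fα fβ → mk⇔ (compose-rejected α β ∘ ≼⇒rejects α β)
                                     (rejects⇒≼ α β fα fβ ∘ compose-fixed⇒rejects α β)
    }
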